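{- Let $\mathcal K=\{1\}$ (paths), let flowers be non-plane, and let $\mathcal N\subseteq\mathbb N^*$ be nonempty and finite. Then $$[z^n]R(z)\sim[z^n]R^*(z)\sim\Big(\prod_{m\in\mathcal N}\frac1m\Big)\frac{n^{|\mathcal N|}}{|\mathcal N|!}.$$ Also, for the class $\mathcal R$, $$[z^n]\Omega(z)\sim\frac1{(|\mathcal N|+1)!}\Big(\prod_{m\in\mathcal N}\frac1m\Big)\Big(\sum_{m\in\mathcal N}\frac1m\Big)n^{|\mathcal N|+1}\ \text{ for }\chi,\qquad [z^n]\Omega(z)\sim\frac{|\mathcal N|}{(|\mathcal N|+1)!}\Big(\prod_{m\in\mathcal N}\frac1m\Big)n^{|\mathcal N|+1}\ \text{ for }\xi,$$ hence $\mathbb E_{\mathcal R_n}(\chi)\sim\frac1{|\mathcal N|+1}\Big(\sum_{m\in\mathcal N}\frac1m\Big)n$ and $\mathbb E_{\mathcal R_n}(\xi)\sim\frac{|\mathcal N|}{|\mathcal N|+1}n$.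
   Context: Non-plane $\mathcal N$-flowers are integer partitions with all parts (petals) in $\mathcal N$, with generating function $F(z)=\prod_{m\in\mathcal N}(1-z^m)^{ -1}$; the size of a flower is the sum of its parts. A path with a flower on the leaf has size equal to the path length plus the flower size; the class $\mathcal R$ has generating function $R(z)=F(z)/(1-z)$, and $\mathcal R^*$ (nonempty flower required) has $R^*(z)=(F(z)-1)/(1-z)$. The parameter $\chi$ is the number of petals (parts) and $\xi$ the number of edges in petals (flower size); their bivariate flower generating functions are $F(z,u)=\prod_{m\in\mathcal N}(1-uz^m)^{ -1}$ and $F(z,u)=F(uz)$ respectively, $F_u(z)=\partial_uF(z,u)|_{u=1}$, and $\Omega(z)=F_u(z)/(1-z)$ is the cumulative generating function of the parameter on $\mathcal R$. $\mathbb E_{\mathcal R_n}(\kappa)=[z^n]\Omega(z)/[z^n]R(z)$ is the mean of $\kappa$ over objects of size $n$ in $\mathcal R$. -}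

module Defs where

open import Data.Nat as ℕ using (ℕ; zero; suc; _+_; _*_; _∸_; _^_; _≤?_; _!; _≤_; z≤n; s≤s)
open import Data.Nat.Properties using (≤-trans; m≤m+n; m≤n+m)
open import Data.List using (List; []; _∷_; [_]; length; filter; concatMap; map; upTo; _++_)
open import Data.Nat.ListAction using (sum)
open import Data.List.Properties using (length-++)
open import Data.Integer using (+_)
open import Data.Rational as ℚ using (ℚ; _/_; ∣_∣; _-_; _<_)
open import Data.Product using (∃; _×_)

-- Flowers (non-plane) with petal sizes in N (given as a list of distinct positive
-- integers) of size k, represented by their multiplicity vectors (c_m)_{m ∈ N}
-- with Σ c_m * m = k.  These are exactly the integer partitions of k with parts in N.
flowers : List ℕ → ℕ → List (List ℕ)
flowers [] zero = [ [] ]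
flowers [] (suc k) = []
flowers (m ∷ ms) k =
  concatMap (λ c → map (c ∷_) (flowers ms (k ∸ c * m)))
            (filter (λ c → c * m ≤? k) (upTo (suc k)))

petals : List ℕ → ℕ
petals cs = sum cs

fCoef : List ℕ → ℕ → ℕ
fCoef N k = length (flowers N k)

Σ≤ : ℕ → (ℕ → ℕ) → ℕ
Σ≤ zero f = f 0
Σ≤ (suc n) f = Σ≤ n f + f (suc n)

-- Objects of R_n (K = {1}): a path of length n - k with a flower of size k at the leaf.
-- [z^n] R(z)
RCoef : List ℕ → ℕ → ℕ
RCoef N n = Σ≤ n (fCoef N)

-- [z^n] R*(z) : nonempty flower required (flower size k ≥ 1)
R*Coef : List ℕ → ℕ → ℕ
R*Coef N zero = 0
R*Coef N (suc n) = Σ≤ n (λ k → fCoef N (suc k))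

ΩχCoef : List ℕ → ℕ → ℕ
ΩχCoef N n = Σ≤ n (λ k → sum (map petals (flowers N k)))

-- [z^n] Ω(z) for ξ : total number of petal edges (flower size) over all objects of R_n
ΩξCoef : List ℕ → ℕ → ℕ
ΩξCoef N n = Σ≤ n (λ k → sum (map (λ _ → k) (flowers N k)))

-- positivity of [z^n]R (the empty flower always exists)
fCoef-0 : ∀ N → 1 ≤ fCoef N 0
fCoef-0 [] = s≤s z≤n
fCoef-0 (m ∷ ms) rewrite length-++ (map (0 ∷_) (flowers ms 0)) {[]}
  | Data.List.Properties.length-map (0 ∷_) (flowers ms 0) =
  ≤-trans (fCoef-0 ms) (m≤m+n _ 0)

Σ≤-0 : ∀ n f → f 0 ≤ Σ≤ n f
Σ≤-0 zero f = Data.Nat.Properties.≤-refl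
Σ≤-0 (suc n) f = ≤-trans (Σ≤-0 n f) (m≤m+n _ _)

RCoef-pos : ∀ N n → 1 ≤ RCoef N n
RCoef-pos N n = ≤-trans (fCoef-0 N) (Σ≤-0 n (fCoef N))

mean : (Ωc : List ℕ → ℕ → ℕ) → List ℕ → ℕ → ℚ
mean Ωc N n = _/_ (+ Ωc N n) (RCoef N n) {{ℕ.>-nonZero (RCoef-pos N n)}}

ℕ→ℚ : ℕ → ℚ
ℕ→ℚ k = + k / 1

-- 1/m for positive m (value 0 at m = 0, never used since N ⊆ ℕ*)
inv : ℕ → ℚ
inv zero = ℚ.0ℚ
inv (suc m) = + 1 / suc m

prodInv : List ℕ → ℚ
prodInv [] = ℚ.1ℚ
prodInv (m ∷ ms) = inv m ℚ.* prodInv ms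

sumInv : List ℕ → ℚ
sumInv [] = ℚ.0ℚ
sumInv (m ∷ ms) = inv m ℚ.+ sumInv ms

_∼_ : (ℕ → ℚ) → (ℕ → ℚ) → Set
a ∼ b = ∀ (ε : ℚ) → ℚ.0ℚ < ε → ∃ λ M → ∀ n → M ≤ n → ∣ a n - b n ∣ ℚ.≤ ε ℚ.* ∣ b n ∣

-- Adding a part m to N divides the flower series by 1 − zᵐ, so the coefficients
-- for m ∷ ms come from those for ms through geom m, f ↦ [zⁿ] f(z)/(1 − zᵐ), and
-- for the two parameters an extra term zᵐ R(z)/(1 − zᵐ)².  Say u is sandwiched by
-- C·nᵉ when C (n − K)ᵉ ≤ u n ≤ C (n + K)ᵉ for a fixed shift K.  Unrolling
-- geom m f n = f n + geom m f (n − m) and using Bernoulli's inequality shows that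
-- m (e + 1) · geom m u is sandwiched by C·nᵉ⁺¹ whenever u is sandwiched by C·nᵉ;
-- sums, products and shifts of sandwiched sequences are sandwiched too.  Induction
-- on N sandwiches every coefficient sequence with the stated constant, and two
-- sequences sandwiched by the same C·nᵉ are asymptotically equal because
-- (n + K)ᵉ / (n − K)ᵉ → 1.

module Submission where

open import Defs

module Counting where

  open import Data.List using (List; []; _∷_; [_]; length; filter; concatMap; map; upTo; _++_)
  open import Data.List.Properties using (map-++; map-∘; upTo-∷ʳ)
  open import Data.Nat
  open import Data.Nat.Induction using (<-rec)
  open import Data.Nat.ListAction using (sum)
  open import Data.Nat.ListAction.Properties using (sum-++)
  open import Data.Nat.Properties
  open import Data.Nat.Tactic.RingSolver using (solve-∀)
  open import Function using (_∘_)
  open import Relation.Binary.PropositionalEquality hiding ([_])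
  open import Relation.Nullary using (Dec; yes; no; ¬_; contradiction)

  when : {P : Set} → Dec P → ℕ → ℕ
  when (yes _) x = x
  when (no _)  _ = 0

  when-+ : ∀ {P : Set} (p : Dec P) x y → when p (x + y) ≡ when p x + when p y
  when-+ (yes _) x y = refl
  when-+ (no _)  x y = refl

  *-when : ∀ {P : Set} (p : Dec P) w x → w * when p x ≡ when p (w * x)
  *-when (yes _) w x = refl
  *-when (no _)  w x = *-zeroʳ w

  when-no : ∀ {P : Set} (p : Dec P) {x} → ¬ P → when p x ≡ 0
  when-no (yes P) ¬P = contradiction P ¬P
  when-no (no _)  _  = refl

  when-yes : ∀ {P : Set} (p : Dec P) {x} → P → when p x ≡ x
  when-yes (yes _) _ = refl
  when-yes (no ¬P) P = contradiction P ¬P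

  when-≤ʳ : ∀ {P : Set} (p : Dec P) {x y} → (P → x ≤ y) → when p x ≤ y
  when-≤ʳ (yes P) x≤y = x≤y P
  when-≤ʳ (no _)  _   = z≤n

  when-cong : ∀ {P : Set} (p : Dec P) {x y} → (P → x ≡ y) → when p x ≡ when p y
  when-cong (yes P) x≡y = x≡y P
  when-cong (no _)  _   = refl

  when-≡ : ∀ {P Q : Set} (p : Dec P) (q : Dec Q) {x y} → (P → Q) → (Q → P) → (P → x ≡ y) → when p x ≡ when q y
  when-≡ (yes P) (yes _) _   _   x≡y = x≡y P
  when-≡ (yes P) (no ¬Q) P→Q _   _   = contradiction (P→Q P) ¬Q
  when-≡ (no ¬P) (yes Q) _   Q→P _   = contradiction (Q→P Q) ¬P
  when-≡ (no _)  (no _)  _   _   _   = refl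

  Σ≤-cong : ∀ n {f g : ℕ → ℕ} → (∀ i → f i ≡ g i) → Σ≤ n f ≡ Σ≤ n g
  Σ≤-cong zero    f≗g = f≗g 0
  Σ≤-cong (suc n) f≗g = cong₂ _+_ (Σ≤-cong n f≗g) (f≗g (suc n))

  Σ≤-+ : ∀ n (f g : ℕ → ℕ) → Σ≤ n (λ i → f i + g i) ≡ Σ≤ n f + Σ≤ n g
  Σ≤-+ zero    f g = refl
  Σ≤-+ (suc n) f g = trans (cong (_+ (f (suc n) + g (suc n))) (Σ≤-+ n f g))
                           (interchange (Σ≤ n f) (Σ≤ n g) (f (suc n)) (g (suc n)))
    where
    interchange : ∀ a b c d → a + b + (c + d) ≡ a + c + (b + d)
    interchange = solve-∀

  *-Σ≤ : ∀ n w (f : ℕ → ℕ) → w * Σ≤ n f ≡ Σ≤ n (λ i → w * f i)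
  *-Σ≤ zero    w f = refl
  *-Σ≤ (suc n) w f = trans (*-distribˡ-+ w (Σ≤ n f) (f (suc n))) (cong (_+ w * f (suc n)) (*-Σ≤ n w f))

  Σ≤-suc : ∀ n (f : ℕ → ℕ) → Σ≤ (suc n) f ≡ f 0 + Σ≤ n (f ∘ suc)
  Σ≤-suc zero    f = refl
  Σ≤-suc (suc n) f = trans (cong (_+ f (suc (suc n))) (Σ≤-suc n f)) (+-assoc (f 0) _ _)

  Σ≤-zeros : ∀ n (f : ℕ → ℕ) → (∀ i → f i ≡ 0) → Σ≤ n f ≡ 0
  Σ≤-zeros zero    f f≗0 = f≗0 0
  Σ≤-zeros (suc n) f f≗0 = cong₂ _+_ (Σ≤-zeros n f f≗0) (f≗0 (suc n))

  Σ≤-tail : ∀ (f : ℕ → ℕ) {a b} → a ≤ b → (∀ i → a < i → f i ≡ 0) → Σ≤ b f ≡ Σ≤ a f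
  Σ≤-tail f {a} a≤b tail = go (≤⇒≤′ a≤b)
    where
    go : ∀ {b} → a ≤′ b → Σ≤ b f ≡ Σ≤ a f
    go ≤′-refl        = refl
    go (≤′-step a≤′b) = trans (cong₂ _+_ (go a≤′b) (tail _ (s≤s (≤′⇒≤ a≤′b)))) (+-identityʳ _)

  -- Σmult m φ n = [zⁿ] Σ_c z^(c·m) Φ_c(z), where φ c j = [zʲ] Φ_c(z).
  Σmult : ℕ → (ℕ → ℕ → ℕ) → ℕ → ℕ
  Σmult m φ n = Σ≤ n λ c → when (c * m ≤? n) (φ c (n ∸ c * m))

  Σmult-cong : ∀ m n {φ ψ : ℕ → ℕ → ℕ} → (∀ c j → φ c j ≡ ψ c j) → Σmult m φ n ≡ Σmult m ψ n
  Σmult-cong m n φ≗ψ = Σ≤-cong n (λ c → cong (when (c * m ≤? n)) (φ≗ψ c (n ∸ c * m)))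

  Σmult-+ : ∀ m (φ ψ : ℕ → ℕ → ℕ) n → Σmult m (λ c j → φ c j + ψ c j) n ≡ Σmult m φ n + Σmult m ψ n
  Σmult-+ m φ ψ n = trans (Σ≤-cong n (λ c → when-+ (c * m ≤? n) _ _)) (Σ≤-+ n _ _)

  *-Σmult : ∀ m w (φ : ℕ → ℕ → ℕ) n → w * Σmult m φ n ≡ Σmult m (λ c j → w * φ c j) n
  *-Σmult m w φ n = trans (*-Σ≤ n w _) (Σ≤-cong n (λ c → *-when (c * m ≤? n) w _))

  *-Σmult-by-index : ∀ m (φ : ℕ → ℕ → ℕ) n → n * Σmult m φ n ≡ Σmult m (λ c j → (c * m + j) * φ c j) n
  *-Σmult-by-index m φ n = trans (*-Σmult m n φ n) (Σ≤-cong n λ c →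
    when-cong (c * m ≤? n) (λ cm≤n → cong (_* φ c (n ∸ c * m)) (sym (m+[n∸m]≡n cm≤n))))

  Σmult-rec : ∀ m .{{_ : NonZero m}} (φ : ℕ → ℕ → ℕ) n →
              Σmult m φ n ≡ φ 0 n + when (m ≤? n) (Σmult m (φ ∘ suc) (n ∸ m))
  Σmult-rec (suc _) φ zero    = sym (+-identityʳ (φ 0 0))
  Σmult-rec m       φ (suc n) = trans (Σ≤-suc n _) (cong (φ 0 (suc n) +_) (later (m ≤? suc n)))
    where
    later : (m≤? : Dec (m ≤ suc n)) →
            Σ≤ n (λ c → when (suc c * m ≤? suc n) (φ (suc c) (suc n ∸ suc c * m))) ≡ when m≤? (Σmult m (φ ∘ suc) (suc n ∸ m))
    later (no m≰) = Σ≤-zeros n _ (λ c → when-no (suc c * m ≤? suc n) (λ p → m≰ (≤-trans (m≤m+n m (c * m)) p)))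
    later (yes m≤) = trans (Σ≤-cong n shifted) (Σ≤-tail _ (∸-monoʳ-≤ (suc n) (>-nonZero⁻¹ m)) vanish)
      where
      shifted : ∀ c → when (suc c * m ≤? suc n) (φ (suc c) (suc n ∸ suc c * m))
                    ≡ when (c * m ≤? suc n ∸ m) (φ (suc c) (suc n ∸ m ∸ c * m))
      shifted c = when-≡ (suc c * m ≤? suc n) (c * m ≤? suc n ∸ m)
        (λ p → subst (_≤ suc n ∸ m) (m+n∸m≡n m (c * m)) (∸-monoˡ-≤ m p))
        (λ q → subst (m + c * m ≤_) (m+[n∸m]≡n m≤) (+-monoʳ-≤ m q))
        (λ _ → cong (φ (suc c)) (sym (∸-+-assoc (suc n) m (c * m))))
      vanish : ∀ i → suc n ∸ m < i → when (i * m ≤? suc n ∸ m) (φ (suc i) (suc n ∸ m ∸ i * m)) ≡ 0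
      vanish i lt = when-no (i * m ≤? suc n ∸ m) (λ im≤ → <⇒≱ lt (≤-trans (m≤m*n i m) im≤))

  Σ≤-Σmult : ∀ m .{{_ : NonZero m}} (φ : ℕ → ℕ → ℕ) n → Σ≤ n (Σmult m φ) ≡ Σmult m (λ c j → Σ≤ j (φ c)) n
  Σ≤-Σmult m φ zero    = refl
  Σ≤-Σmult m φ (suc n) = begin
    Σ≤ n (Σmult m φ) + Σmult m φ (suc n)                ≡⟨ cong (_+ Σmult m φ (suc n)) (Σ≤-Σmult m φ n) ⟩
    Σ≤ n old + Σmult m φ (suc n)                        ≡⟨ cong (_+ Σmult m φ (suc n)) (sym (+-identityʳ (Σ≤ n old))) ⟩
    Σ≤ n old + 0 + Σmult m φ (suc n)                    ≡⟨ cong (λ x → Σ≤ n old + x + Σmult m φ (suc n)) (sym old-vanishes) ⟩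
    Σ≤ n old + old (suc n) + Σmult m φ (suc n)          ≡⟨ sym (Σ≤-+ (suc n) old new) ⟩
    Σ≤ (suc n) (λ c → old c + new c)                    ≡⟨ Σ≤-cong (suc n) (λ c → sym (split (φ c) (c * m))) ⟩
    Σmult m (λ c j → Σ≤ j (φ c)) (suc n)                ∎
    where
    open ≡-Reasoning
    old new : ℕ → ℕ
    old c = when (c * m ≤? n) (Σ≤ (n ∸ c * m) (φ c))
    new c = when (c * m ≤? suc n) (φ c (suc n ∸ c * m))
    old-vanishes : old (suc n) ≡ 0
    old-vanishes = when-no (suc n * m ≤? n) (λ p → <⇒≱ (n<1+n n) (≤-trans (m≤m*n (suc n) m) p))
    split : ∀ (g : ℕ → ℕ) a → when (a ≤? suc n) (Σ≤ (suc n ∸ a) g)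
                             ≡ when (a ≤? n) (Σ≤ (n ∸ a) g) + when (a ≤? suc n) (g (suc n ∸ a))
    split g a with a ≤? n | a ≤? suc n
    ... | yes a≤n | yes _    rewrite +-∸-assoc 1 a≤n = refl
    ... | yes a≤n | no a≰1+n = contradiction (m≤n⇒m≤1+n a≤n) a≰1+n
    ... | no a≰n  | yes _    rewrite m≤n⇒m∸n≡0 (≰⇒> a≰n) = refl
    ... | no _    | no _     = refl

  -- [zⁿ] f(z) / (1 − zᵐ)
  geom : ℕ → (ℕ → ℕ) → ℕ → ℕ
  geom m f = Σmult m (λ _ → f)

  -- [zⁿ] zᵐ f(z) / (1 − zᵐ)²
  weightedGeom : ℕ → (ℕ → ℕ) → ℕ → ℕ
  weightedGeom m f = Σmult m (λ c j → c * f j)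

  geom-rec : ∀ m .{{_ : NonZero m}} f n → geom m f n ≡ f n + when (m ≤? n) (geom m f (n ∸ m))
  geom-rec m f = Σmult-rec m (λ _ → f)

  weightedGeom-rec : ∀ m .{{_ : NonZero m}} f n → weightedGeom m f n ≡ when (m ≤? n) (geom m (geom m f) (n ∸ m))
  weightedGeom-rec m f = <-rec _ λ n rec → trans (Σmult-rec m (λ c j → c * f j) n)
    (when-cong (m ≤? n) λ m≤n → begin
      Σmult m (λ c j → f j + c * f j) (n ∸ m)                                  ≡⟨ Σmult-+ m (λ _ → f) (λ c j → c * f j) (n ∸ m) ⟩
      geom m f (n ∸ m) + weightedGeom m f (n ∸ m)
        ≡⟨ cong (geom m f (n ∸ m) +_) (rec (∸-monoʳ-< (>-nonZero⁻¹ m) m≤n)) ⟩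
      geom m f (n ∸ m) + when (m ≤? n ∸ m) (geom m (geom m f) (n ∸ m ∸ m))     ≡⟨ sym (geom-rec m (geom m f) (n ∸ m)) ⟩
      geom m (geom m f) (n ∸ m)                                                ∎)
    where open ≡-Reasoning

  sum-map-+ : ∀ {A : Set} (f g : A → ℕ) xs → sum (map (λ x → f x + g x) xs) ≡ sum (map f xs) + sum (map g xs)
  sum-map-+ f g []       = refl
  sum-map-+ f g (x ∷ xs) = trans (cong (f x + g x +_) (sum-map-+ f g xs)) (interchange (f x) (g x) _ _)
    where
    interchange : ∀ a b c d → a + b + (c + d) ≡ a + c + (b + d)
    interchange = solve-∀

  sum-map-const : ∀ {A : Set} c (xs : List A) → sum (map (λ _ → c) xs) ≡ c * length xs
  sum-map-const c []       = sym (*-zeroʳ c)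
  sum-map-const c (x ∷ xs) = trans (cong (c +_) (sum-map-const c xs)) (sym (*-suc c (length xs)))

  length≡sum : ∀ {A : Set} (xs : List A) → length xs ≡ sum (map (λ _ → 1) xs)
  length≡sum xs = trans (sym (*-identityˡ (length xs))) (sym (sum-map-const 1 xs))

  sum-map-concatMap : ∀ {A B : Set} (g : B → ℕ) (F : A → List B) xs →
                      sum (map g (concatMap F xs)) ≡ sum (map (λ x → sum (map g (F x))) xs)
  sum-map-concatMap g F []       = refl
  sum-map-concatMap g F (x ∷ xs) = begin
    sum (map g (F x ++ concatMap F xs))                     ≡⟨ cong sum (map-++ g (F x) (concatMap F xs)) ⟩
    sum (map g (F x) ++ map g (concatMap F xs))             ≡⟨ sum-++ (map g (F x)) _ ⟩
    sum (map g (F x)) + sum (map g (concatMap F xs))        ≡⟨ cong (sum (map g (F x)) +_) (sum-map-concatMap g F xs) ⟩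
    sum (map g (F x)) + sum (map (λ y → sum (map g (F y))) xs) ∎
    where open ≡-Reasoning

  sum-map-filter : ∀ {A : Set} {P : A → Set} (P? : ∀ x → Dec (P x)) (h : A → ℕ) xs →
                   sum (map h (filter P? xs)) ≡ sum (map (λ x → when (P? x) (h x)) xs)
  sum-map-filter P? h []       = refl
  sum-map-filter P? h (x ∷ xs) with P? x
  ... | yes _ = cong (h x +_) (sum-map-filter P? h xs)
  ... | no _  = sum-map-filter P? h xs

  sum-map-upTo : ∀ (g : ℕ → ℕ) k → sum (map g (upTo (suc k))) ≡ Σ≤ k g
  sum-map-upTo g zero    = +-identityʳ (g 0)
  sum-map-upTo g (suc k) = begin
    sum (map g (upTo (suc (suc k))))              ≡⟨ cong (sum ∘ map g) (upTo-∷ʳ (suc k)) ⟨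
    sum (map g (upTo (suc k) ++ [ suc k ]))       ≡⟨ cong sum (map-++ g (upTo (suc k)) [ suc k ]) ⟩
    sum (map g (upTo (suc k)) ++ [ g (suc k) ])   ≡⟨ sum-++ (map g (upTo (suc k))) [ g (suc k) ] ⟩
    sum (map g (upTo (suc k))) + (g (suc k) + 0)  ≡⟨ cong₂ _+_ (sum-map-upTo g k) (+-identityʳ (g (suc k))) ⟩
    Σ≤ k g + g (suc k)                            ∎
    where open ≡-Reasoning

  sum-map-flowers : ∀ (g : List ℕ → ℕ) m ms k →
    sum (map g (flowers (m ∷ ms) k)) ≡ Σmult m (λ c j → sum (map (g ∘ (c ∷_)) (flowers ms j))) k
  sum-map-flowers g m ms k = begin
    sum (map g (concatMap F (filter (λ c → c * m ≤? k) (upTo (suc k)))))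
      ≡⟨ sum-map-concatMap g F (filter (λ c → c * m ≤? k) (upTo (suc k))) ⟩
    sum (map (λ c → sum (map g (F c))) (filter (λ c → c * m ≤? k) (upTo (suc k))))
      ≡⟨ sum-map-filter (λ c → c * m ≤? k) _ (upTo (suc k)) ⟩
    sum (map (λ c → when (c * m ≤? k) (sum (map g (F c)))) (upTo (suc k)))
      ≡⟨ sum-map-upTo _ k ⟩
    Σ≤ k (λ c → when (c * m ≤? k) (sum (map g (F c))))
      ≡⟨ Σ≤-cong k (λ c → cong (λ xs → when (c * m ≤? k) (sum xs)) (sym (map-∘ (flowers ms (k ∸ c * m))))) ⟩
    Σmult m (λ c j → sum (map (g ∘ (c ∷_)) (flowers ms j))) k ∎
    where
    open ≡-Reasoning
    F : ℕ → List (List ℕ)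
    F c = map (c ∷_) (flowers ms (k ∸ c * m))

  fCoef-∷ : ∀ m ms k → fCoef (m ∷ ms) k ≡ geom m (fCoef ms) k
  fCoef-∷ m ms k = trans (length≡sum (flowers (m ∷ ms) k)) (trans (sum-map-flowers (λ _ → 1) m ms k)
    (Σmult-cong m k (λ c j → sym (length≡sum (flowers ms j)))))

  fCoef-zero : ∀ N → fCoef N 0 ≡ 1
  fCoef-zero []       = refl
  fCoef-zero (m ∷ ms) = trans (fCoef-∷ m ms 0) (fCoef-zero ms)

  sum-petals-∷ : ∀ m ms k → sum (map petals (flowers (m ∷ ms) k))
               ≡ Σmult m (λ c j → c * fCoef ms j + sum (map petals (flowers ms j))) k
  sum-petals-∷ m ms k = trans (sum-map-flowers petals m ms k) (Σmult-cong m k λ c j →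
    trans (sum-map-+ (λ _ → c) petals (flowers ms j)) (cong (_+ _) (sum-map-const c (flowers ms j))))

  RCoef-[] : ∀ n → RCoef [] n ≡ 1
  RCoef-[] n = Σ≤-tail (fCoef []) {0} {n} z≤n λ { (suc _) _ → refl }

  ΩχCoef-[] : ∀ n → ΩχCoef [] n ≡ 0
  ΩχCoef-[] n = Σ≤-zeros n _ λ { zero → refl ; (suc _) → refl }

  ΩξCoef-[] : ∀ n → ΩξCoef [] n ≡ 0
  ΩξCoef-[] n = Σ≤-zeros n _ λ { zero → refl ; (suc _) → refl }

  RCoef≡R*Coef+1 : ∀ N n → RCoef N n ≡ R*Coef N n + 1
  RCoef≡R*Coef+1 N zero    = fCoef-zero N
  RCoef≡R*Coef+1 N (suc n) = trans (Σ≤-suc n (fCoef N)) (trans (cong (_+ R*Coef N (suc n)) (fCoef-zero N)) (+-comm 1 _))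

  RCoef-∷ : ∀ m .{{_ : NonZero m}} ms n → RCoef (m ∷ ms) n ≡ geom m (RCoef ms) n
  RCoef-∷ m ms n = trans (Σ≤-cong n (fCoef-∷ m ms)) (Σ≤-Σmult m (λ _ → fCoef ms) n)

  ΩχCoef-∷ : ∀ m .{{_ : NonZero m}} ms n → ΩχCoef (m ∷ ms) n ≡ weightedGeom m (RCoef ms) n + geom m (ΩχCoef ms) n
  ΩχCoef-∷ m ms n = begin
    Σ≤ n (λ k → sum (map petals (flowers (m ∷ ms) k)))   ≡⟨ Σ≤-cong n (sum-petals-∷ m ms) ⟩
    Σ≤ n (Σmult m φ)                                     ≡⟨ Σ≤-Σmult m φ n ⟩
    Σmult m (λ c j → Σ≤ j (φ c)) n
      ≡⟨ Σmult-cong m n (λ c j → trans (Σ≤-+ j _ _) (cong (_+ ΩχCoef ms j) (sym (*-Σ≤ j c (fCoef ms))))) ⟩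
    Σmult m (λ c j → c * RCoef ms j + ΩχCoef ms j) n     ≡⟨ Σmult-+ m (λ c j → c * RCoef ms j) (λ _ → ΩχCoef ms) n ⟩
    weightedGeom m (RCoef ms) n + geom m (ΩχCoef ms) n   ∎
    where
    open ≡-Reasoning
    φ : ℕ → ℕ → ℕ
    φ c j = c * fCoef ms j + sum (map petals (flowers ms j))

  ΩξCoef≡Σ≤ : ∀ N n → ΩξCoef N n ≡ Σ≤ n (λ k → k * fCoef N k)
  ΩξCoef≡Σ≤ N n = Σ≤-cong n (λ k → sum-map-const k (flowers N k))

  ΩξCoef-∷ : ∀ m .{{_ : NonZero m}} ms n → ΩξCoef (m ∷ ms) n ≡ m * weightedGeom m (RCoef ms) n + geom m (ΩξCoef ms) n
  ΩξCoef-∷ m ms n = begin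
    ΩξCoef (m ∷ ms) n                                        ≡⟨ ΩξCoef≡Σ≤ (m ∷ ms) n ⟩
    Σ≤ n (λ k → k * fCoef (m ∷ ms) k)
      ≡⟨ Σ≤-cong n (λ k → trans (cong (k *_) (fCoef-∷ m ms k)) (*-Σmult-by-index m (λ _ → fCoef ms) k)) ⟩
    Σ≤ n (Σmult m φ)                                         ≡⟨ Σ≤-Σmult m φ n ⟩
    Σmult m (λ c j → Σ≤ j (φ c)) n                           ≡⟨ Σmult-cong m n split ⟩
    Σmult m (λ c j → m * (c * RCoef ms j) + ΩξCoef ms j) n   ≡⟨ Σmult-+ m (λ c j → m * (c * RCoef ms j)) (λ _ → ΩξCoef ms) n ⟩
    Σmult m (λ c j → m * (c * RCoef ms j)) n + geom m (ΩξCoef ms) n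
      ≡⟨ cong (_+ geom m (ΩξCoef ms) n) (sym (*-Σmult m m (λ c j → c * RCoef ms j) n)) ⟩
    m * weightedGeom m (RCoef ms) n + geom m (ΩξCoef ms) n   ∎
    where
    open ≡-Reasoning
    φ : ℕ → ℕ → ℕ
    φ c j = (c * m + j) * fCoef ms j
    split : ∀ c j → Σ≤ j (φ c) ≡ m * (c * RCoef ms j) + ΩξCoef ms j
    split c j = begin
      Σ≤ j (φ c)                                              ≡⟨ Σ≤-cong j (λ i → *-distribʳ-+ (fCoef ms i) (c * m) i) ⟩
      Σ≤ j (λ i → c * m * fCoef ms i + i * fCoef ms i)        ≡⟨ Σ≤-+ j _ _ ⟩
      Σ≤ j (λ i → c * m * fCoef ms i) + Σ≤ j (λ i → i * fCoef ms i)
        ≡⟨ cong₂ _+_ (sym (*-Σ≤ j (c * m) (fCoef ms))) (sym (ΩξCoef≡Σ≤ ms j)) ⟩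
      c * m * RCoef ms j + ΩξCoef ms j                         ≡⟨ cong (_+ ΩξCoef ms j) (reassoc c m (RCoef ms j)) ⟩
      m * (c * RCoef ms j) + ΩξCoef ms j                       ∎
      where
      reassoc : ∀ c m r → c * m * r ≡ m * (c * r)
      reassoc = solve-∀

module Sandwiches where

  open import Data.Nat
  open import Data.Nat.Induction using (<-rec)
  open import Data.Nat.Properties
  open import Data.Nat.Tactic.RingSolver using (solve-∀)
  open import Data.Product using (∃; _×_; _,_)
  open import Relation.Binary.PropositionalEquality
  open import Relation.Nullary using (Dec; yes; no; contradiction)
  open Counting

  Eventually : (ℕ → Set) → Set
  Eventually P = ∃ λ M → ∀ n → M ≤ n → P n

  Eventually-map : ∀ {P Q : ℕ → Set} → (∀ {n} → P n → Q n) → Eventually P → Eventually Q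
  Eventually-map f (M , p) = M , λ n M≤n → f (p n M≤n)

  Eventually-× : ∀ {P Q : ℕ → Set} → Eventually P → Eventually Q → Eventually (λ n → P n × Q n)
  Eventually-× (M , p) (M′ , q) =
    M + M′ , λ n M+M′≤n → p n (≤-trans (m≤m+n M M′) M+M′≤n) , q n (≤-trans (m≤n+m M′ M) M+M′≤n)

  _≈∞_ : (ℕ → ℕ) → (ℕ → ℕ) → Set
  u ≈∞ v = ∀ k → Eventually λ n → k * v n ≤ suc k * u n × suc k * u n ≤ suc (suc k) * v n

  record Sandwiched (u : ℕ → ℕ) (C e : ℕ) : Set where
    constructor sandwiched
    field
      shift : ℕ
      lower : ∀ n → C * (n ∸ shift) ^ e ≤ u n
      upper : ∀ n → u n ≤ C * (n + shift) ^ e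

  open Sandwiched

  Sandwiched-widen : ∀ {u C e} (s : Sandwiched u C e) K → shift s ≤ K → Sandwiched u C e
  Sandwiched-widen {C = C} {e} s K K₀≤K = sandwiched K
    (λ n → ≤-trans (*-monoʳ-≤ C (^-monoˡ-≤ e (∸-monoʳ-≤ n K₀≤K))) (lower s n))
    (λ n → ≤-trans (upper s n) (*-monoʳ-≤ C (^-monoˡ-≤ e (+-monoʳ-≤ n K₀≤K))))

  Sandwiched-ext : ∀ {u v C e} → (∀ n → u n ≡ v n) → Sandwiched u C e → Sandwiched v C e
  Sandwiched-ext u≗v (sandwiched K lo hi) = sandwiched K
    (λ n → subst (_ ≤_) (u≗v n) (lo n)) (λ n → subst (_≤ _) (u≗v n) (hi n))

  Sandwiched-monomial : ∀ C e → Sandwiched (λ n → C * n ^ e) C e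
  Sandwiched-monomial C e = sandwiched 0 (λ n → ≤-refl) (λ n → ≤-reflexive (cong (λ x → C * x ^ e) (sym (+-identityʳ n))))

  Sandwiched-const : ∀ c → Sandwiched (λ _ → c) c 0
  Sandwiched-const c = Sandwiched-ext (λ _ → *-identityʳ c) (Sandwiched-monomial c 0)

  Sandwiched-id : Sandwiched (λ n → n) 1 1
  Sandwiched-id = Sandwiched-ext (λ n → trans (*-identityˡ (n ^ 1)) (*-identityʳ n)) (Sandwiched-monomial 1 1)

  Sandwiched-+ : ∀ {u v C C′ e} → Sandwiched u C e → Sandwiched v C′ e →
                 Sandwiched (λ n → u n + v n) (C + C′) e
  Sandwiched-+ {C = C} {C′} {e} s s′ = sandwiched K
    (λ n → ≤-trans (≤-reflexive (*-distribʳ-+ ((n ∸ K) ^ e) C C′)) (+-mono-≤ (lower s₁ n) (lower s₂ n)))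
    (λ n → ≤-trans (+-mono-≤ (upper s₁ n) (upper s₂ n)) (≤-reflexive (sym (*-distribʳ-+ ((n + K) ^ e) C C′))))
    where
    K = shift s + shift s′
    s₁ = Sandwiched-widen s K (m≤m+n _ _)
    s₂ = Sandwiched-widen s′ K (m≤n+m _ _)

  Sandwiched-* : ∀ {u v C C′ e e′} → Sandwiched u C e → Sandwiched v C′ e′ →
                 Sandwiched (λ n → u n * v n) (C * C′) (e + e′)
  Sandwiched-* {C = C} {C′} {e} {e′} s s′ = sandwiched K
    (λ n → ≤-trans (≤-reflexive (sym (split (n ∸ K)))) (*-mono-≤ (lower s₁ n) (lower s₂ n)))
    (λ n → ≤-trans (*-mono-≤ (upper s₁ n) (upper s₂ n)) (≤-reflexive (split (n + K))))
    where
    K = shift s + shift s′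
    s₁ = Sandwiched-widen s K (m≤m+n _ _)
    s₂ = Sandwiched-widen s′ K (m≤n+m _ _)
    split : ∀ x → C * x ^ e * (C′ * x ^ e′) ≡ C * C′ * x ^ (e + e′)
    split x = trans ([m*n]*[o*p]≡[m*o]*[n*p] C (x ^ e) C′ (x ^ e′)) (cong (C * C′ *_) (sym (^-distribˡ-+-* x e e′)))

  shift-power-ratio : ∀ e L k → Eventually λ x → k * (x + L) ^ e ≤ suc k * x ^ e
  shift-power-ratio zero L k = 0 , λ _ _ → *-monoˡ-≤ 1 (n≤1+n k)
  shift-power-ratio (suc e) L k =
    Eventually-map step (Eventually-× (shift-power-ratio e L (suc (k + k))) ((k + k) * L , λ _ 2kL≤x → 2kL≤x))
    where
    step : ∀ {x} → suc (k + k) * (x + L) ^ e ≤ suc (suc (k + k)) * x ^ e × (k + k) * L ≤ x →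
           k * (x + L) ^ suc e ≤ suc k * x ^ suc e
    step {x} (ih , 2kL≤x) = *-cancelˡ-≤ (suc (k + k)) (begin
      suc (k + k) * (k * ((x + L) * a))      ≡⟨ e₁ k x L a ⟩
      k * (x + L) * (suc (k + k) * a)        ≤⟨ *-monoʳ-≤ (k * (x + L)) ih ⟩
      k * (x + L) * (suc (suc (k + k)) * b)  ≡⟨ e₂ k x L b ⟩
      suc k * ((k + k) * x + (k + k) * L) * b ≤⟨ *-monoˡ-≤ b (*-monoʳ-≤ (suc k) (+-monoʳ-≤ ((k + k) * x) 2kL≤x)) ⟩
      suc k * ((k + k) * x + x) * b          ≡⟨ e₃ k x b ⟩
      suc (k + k) * (suc k * (x * b))        ∎)
      where
      open ≤-Reasoning
      a = (x + L) ^ e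
      b = x ^ e
      e₁ : ∀ k x L a → suc (k + k) * (k * ((x + L) * a)) ≡ k * (x + L) * (suc (k + k) * a)
      e₁ = solve-∀
      e₂ : ∀ k x L b → k * (x + L) * (suc (suc (k + k)) * b) ≡ suc k * ((k + k) * x + (k + k) * L) * b
      e₂ = solve-∀
      e₃ : ∀ k x b → suc k * ((k + k) * x + x) * b ≡ suc (k + k) * (suc k * (x * b))
      e₃ = solve-∀

  shift±-power-ratio : ∀ K e k → Eventually λ n → k * (n + K) ^ e ≤ suc k * (n ∸ K) ^ e
  shift±-power-ratio K e k with shift-power-ratio e (K + K) k
  ... | M , close = M + K , λ n M+K≤n →
    subst (λ x → k * x ^ e ≤ suc k * (n ∸ K) ^ e) (n∸K+2K≡n+K n (≤-trans (m≤n+m K M) M+K≤n))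
      (close (n ∸ K) (subst (_≤ n ∸ K) (m+n∸n≡m M K) (∸-monoˡ-≤ K M+K≤n)))
    where
    n∸K+2K≡n+K : ∀ n → K ≤ n → n ∸ K + (K + K) ≡ n + K
    n∸K+2K≡n+K n K≤n = trans (sym (+-assoc (n ∸ K) K K)) (cong (_+ K) (m∸n+n≡m K≤n))

  ratio-bound : ∀ j {L U x y} → j * U ≤ suc j * L → x ≤ U → L ≤ y → j * x ≤ suc j * y
  ratio-bound j jU≤j′L x≤U L≤y = ≤-trans (*-monoʳ-≤ j x≤U) (≤-trans jU≤j′L (*-monoʳ-≤ (suc j) L≤y))

  Sandwiched⇒≈∞ : ∀ {u v C e} → Sandwiched u C e → Sandwiched v C e → u ≈∞ v
  Sandwiched⇒≈∞ {u} {v} {C} {e} s s′ k =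
    Eventually-map close (Eventually-× (shift±-power-ratio K e k) (shift±-power-ratio K e (suc k)))
    where
    K = shift s + shift s′
    s₁ = Sandwiched-widen s K (m≤m+n _ _)
    s₂ = Sandwiched-widen s′ K (m≤n+m _ _)
    scale : ∀ j n → j * (n + K) ^ e ≤ suc j * (n ∸ K) ^ e →
            j * (C * (n + K) ^ e) ≤ suc j * (C * (n ∸ K) ^ e)
    scale j n h = subst₂ _≤_ (swap C j _) (swap C (suc j) _) (*-monoʳ-≤ C h)
      where
      swap : ∀ a b c → a * (b * c) ≡ b * (a * c)
      swap = solve-∀
    close : ∀ {n} → k * (n + K) ^ e ≤ suc k * (n ∸ K) ^ e × suc k * (n + K) ^ e ≤ suc (suc k) * (n ∸ K) ^ e →
            k * v n ≤ suc k * u n × suc k * u n ≤ suc (suc k) * v n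
    close {n} (h , h′) = ratio-bound k (scale k n h) (upper s₂ n) (lower s₁ n)
                       , ratio-bound (suc k) (scale (suc k) n h′) (upper s₁ n) (lower s₂ n)

  bernoulli-lower : ∀ x m e → x ^ suc e + suc e * m * x ^ e ≤ (x + m) ^ suc e
  bernoulli-lower x m zero    = ≤-reflexive (base x m)
    where
    base : ∀ x m → x * 1 + 1 * m * 1 ≡ (x + m) * 1
    base = solve-∀
  bernoulli-lower x m (suc e) = begin
    x * (x * a) + suc (suc e) * m * (x * a)                     ≤⟨ m≤m+n _ (suc e * m * m * a) ⟩
    x * (x * a) + suc (suc e) * m * (x * a) + suc e * m * m * a ≡⟨ expand x m e a ⟩
    (x + m) * (x * a + suc e * m * a)                           ≤⟨ *-monoʳ-≤ (x + m) (bernoulli-lower x m e) ⟩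
    (x + m) * (x + m) ^ suc e                                   ∎
    where
    open ≤-Reasoning
    a = x ^ e
    expand : ∀ x m e a → x * (x * a) + suc (suc e) * m * (x * a) + suc e * m * m * a ≡ (x + m) * (x * a + suc e * m * a)
    expand = solve-∀

  bernoulli-upper : ∀ y m e → (y + m) ^ suc e ≤ y ^ suc e + suc e * m * (y + m) ^ e
  bernoulli-upper y m zero    = ≤-reflexive (base y m)
    where
    base : ∀ y m → (y + m) * 1 ≡ y * 1 + 1 * m * 1
    base = solve-∀
  bernoulli-upper y m (suc e) = begin
    (y + m) * (y + m) ^ suc e                     ≤⟨ *-monoʳ-≤ (y + m) (bernoulli-upper y m e) ⟩
    (y + m) * (y * a + suc e * m * b)             ≡⟨ expand y m e a b ⟩
    y * (y * a) + m * (y * a) + suc e * m * c     ≤⟨ +-monoˡ-≤ _ (+-monoʳ-≤ (y * (y * a)) (*-monoʳ-≤ m y^e+1≤c)) ⟩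
    y * (y * a) + m * c + suc e * m * c           ≡⟨ collect (y * (y * a)) m e c ⟩
    y * (y * a) + suc (suc e) * m * c             ∎
    where
    open ≤-Reasoning
    a = y ^ e
    b = (y + m) ^ e
    c = (y + m) * b
    y^e+1≤c : y * a ≤ c
    y^e+1≤c = ^-monoˡ-≤ (suc e) (m≤m+n y m)
    expand : ∀ y m e a b → (y + m) * (y * a + suc e * m * b) ≡ y * (y * a) + m * (y * a) + suc e * m * ((y + m) * b)
    expand = solve-∀
    collect : ∀ z m e c → z + m * c + suc e * m * c ≡ z + suc (suc e) * m * c
    collect = solve-∀

  module _ m .{{_ : NonZero m}} {u : ℕ → ℕ} {C e} (s : Sandwiched u C e) where
    private
      K = shift s
      w = m * suc e

      G : ℕ → ℕ
      G n = w * geom m u n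

      G-rec : ∀ n → G n ≡ w * u n + when (m ≤? n) (G (n ∸ m))
      G-rec n = trans (cong (w *_) (geom-rec m u n))
                      (trans (*-distribˡ-+ w (u n) _) (cong (w * u n +_) (*-when (m ≤? n) w _)))

      n∸m<n : ∀ {n} → m ≤ n → n ∸ m < n
      n∸m<n = ∸-monoʳ-< (>-nonZero⁻¹ m)

      regroup : ∀ m e C a b → m * suc e * (C * a) + C * b ≡ C * (b + suc e * m * a)
      regroup = solve-∀

      G-upper : ∀ n → G n ≤ C * (n + (K + m)) ^ suc e
      G-upper = <-rec _ λ n rec → begin
        G n                                              ≡⟨ G-rec n ⟩
        w * u n + when (m ≤? n) (G (n ∸ m))              ≤⟨ +-mono-≤ (*-monoʳ-≤ w (upper s n)) (when-≤ʳ (m ≤? n) (earlier n rec)) ⟩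
        w * (C * (n + K) ^ e) + C * (n + K) ^ suc e      ≡⟨ regroup m e C ((n + K) ^ e) ((n + K) ^ suc e) ⟩
        C * ((n + K) ^ suc e + suc e * m * (n + K) ^ e)  ≤⟨ *-monoʳ-≤ C (bernoulli-lower (n + K) m e) ⟩
        C * (n + K + m) ^ suc e                          ≡⟨ cong (λ x → C * x ^ suc e) (+-assoc n K m) ⟩
        C * (n + (K + m)) ^ suc e                        ∎
        where
        open ≤-Reasoning
        earlier : ∀ n → (∀ {n′} → n′ < n → G n′ ≤ C * (n′ + (K + m)) ^ suc e) → m ≤ n → G (n ∸ m) ≤ C * (n + K) ^ suc e
        earlier n rec m≤n = subst (λ x → G (n ∸ m) ≤ C * x ^ suc e) (begin-equality
          n ∸ m + (K + m)  ≡⟨ cong (n ∸ m +_) (+-comm K m) ⟩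
          n ∸ m + (m + K)  ≡⟨ sym (+-assoc (n ∸ m) m K) ⟩
          n ∸ m + m + K    ≡⟨ cong (_+ K) (m∸n+n≡m m≤n) ⟩
          n + K            ∎) (rec (n∸m<n m≤n))

      G-lower : ∀ n → C * (n ∸ K) ^ suc e ≤ G n
      G-lower = <-rec _ λ n rec → by-size n rec (n ∸ K ≤? m)
        where
        swap : ∀ a b c → a * (b * c) ≡ b * (a * c)
        swap = solve-∀
        by-size : ∀ n → (∀ {n′} → n′ < n → C * (n′ ∸ K) ^ suc e ≤ G n′) → Dec (n ∸ K ≤ m) → C * (n ∸ K) ^ suc e ≤ G n
        by-size n _ (yes small) = begin
          C * ((n ∸ K) * (n ∸ K) ^ e)          ≤⟨ *-monoʳ-≤ C (*-monoˡ-≤ ((n ∸ K) ^ e) small) ⟩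
          C * (m * (n ∸ K) ^ e)                ≡⟨ swap C m _ ⟩
          m * (C * (n ∸ K) ^ e)                ≤⟨ *-monoʳ-≤ m (lower s n) ⟩
          m * u n                              ≤⟨ *-monoˡ-≤ (u n) (m≤m*n m (suc e)) ⟩
          w * u n                              ≤⟨ m≤m+n (w * u n) _ ⟩
          w * u n + when (m ≤? n) (G (n ∸ m))  ≡⟨ G-rec n ⟨
          G n                                  ∎
          where open ≤-Reasoning
        by-size n rec (no large) = begin
          C * (n ∸ K) ^ suc e                            ≡⟨ cong (λ x → C * x ^ suc e) (sym y+m≡n∸K) ⟩
          C * (y + m) ^ suc e                            ≤⟨ *-monoʳ-≤ C (bernoulli-upper y m e) ⟩
          C * (y ^ suc e + suc e * m * (y + m) ^ e)      ≡⟨ regroup m e C ((y + m) ^ e) (y ^ suc e) ⟨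
          w * (C * (y + m) ^ e) + C * y ^ suc e          ≡⟨ cong₂ (λ x z → w * (C * x ^ e) + C * z ^ suc e) y+m≡n∸K (sym n∸m∸K≡y) ⟩
          w * (C * (n ∸ K) ^ e) + C * (n ∸ m ∸ K) ^ suc e ≤⟨ +-mono-≤ (*-monoʳ-≤ w (lower s n)) (rec (n∸m<n m≤n)) ⟩
          w * u n + G (n ∸ m)                            ≡⟨ cong (w * u n +_) (when-yes (m ≤? n) m≤n) ⟨
          w * u n + when (m ≤? n) (G (n ∸ m))            ≡⟨ G-rec n ⟨
          G n                                            ∎
          where
          open ≤-Reasoning
          y = n ∸ K ∸ m
          m≤n∸K = <⇒≤ (≰⇒> large)
          m≤n = ≤-trans m≤n∸K (m∸n≤m n K)
          y+m≡n∸K : y + m ≡ n ∸ K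
          y+m≡n∸K = m∸n+n≡m m≤n∸K
          n∸m∸K≡y : n ∸ m ∸ K ≡ y
          n∸m∸K≡y = trans (∸-+-assoc n m K) (trans (cong (n ∸_) (+-comm m K)) (sym (∸-+-assoc n K m)))

    Sandwiched-geom : Sandwiched (λ n → m * suc e * geom m u n) C (suc e)
    Sandwiched-geom = sandwiched (K + m)
      (λ n → ≤-trans (*-monoʳ-≤ C (^-monoˡ-≤ (suc e) (∸-monoʳ-≤ n (m≤m+n K m)))) (G-lower n))
      G-upper

  Sandwiched-delay : ∀ m {u C e} → Sandwiched u C (suc e) → Sandwiched (λ n → when (m ≤? n) (u (n ∸ m))) C (suc e)
  Sandwiched-delay m {u} {C} {e} s = sandwiched (m + K) lo hi
    where
    K = shift s
    lo : ∀ n → C * (n ∸ (m + K)) ^ suc e ≤ when (m ≤? n) (u (n ∸ m))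
    lo n with m ≤? n
    ... | yes _   = subst (λ x → C * x ^ suc e ≤ u (n ∸ m)) (∸-+-assoc n m K) (lower s (n ∸ m))
    ... | no m≰n  = ≤-reflexive (trans (cong (λ x → C * x ^ suc e) (m≤n⇒m∸n≡0 n≤m+K)) (*-zeroʳ C))
      where n≤m+K = ≤-trans (<⇒≤ (≰⇒> m≰n)) (m≤m+n m K)
    hi : ∀ n → when (m ≤? n) (u (n ∸ m)) ≤ C * (n + (m + K)) ^ suc e
    hi n = when-≤ʳ (m ≤? n) λ _ →
      ≤-trans (upper s (n ∸ m)) (*-monoʳ-≤ C (^-monoˡ-≤ (suc e) (+-mono-≤ (m∸n≤m n m) (m≤n+m K m))))

  Sandwiched-nonZero : ∀ {u C e} → Sandwiched u C e → ∀ n → .{{NonZero (u n)}} → NonZero C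
  Sandwiched-nonZero {u} {zero}  s n = contradiction (n≤0⇒n≡0 (upper s n)) (≢-nonZero⁻¹ (u n))
  Sandwiched-nonZero {u} {suc _} s n = _

  Sandwiched-∸ : ∀ {u v C e} c .{{_ : NonZero C}} → Sandwiched u C (suc e) → (∀ n → u n ≡ v n + c) →
                 Sandwiched v C (suc e)
  Sandwiched-∸ {u} {v} {C} {e} c s u≡v+c = sandwiched (K + c) lo hi
    where
    K = shift s
    hi : ∀ n → v n ≤ C * (n + (K + c)) ^ suc e
    hi n = begin
      v n                       ≤⟨ m≤m+n (v n) c ⟩
      v n + c                   ≡⟨ u≡v+c n ⟨
      u n                       ≤⟨ upper s n ⟩
      C * (n + K) ^ suc e       ≤⟨ *-monoʳ-≤ C (^-monoˡ-≤ (suc e) (+-monoʳ-≤ n (m≤m+n K c))) ⟩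
      C * (n + (K + c)) ^ suc e ∎
      where open ≤-Reasoning
    lo : ∀ n → C * (n ∸ (K + c)) ^ suc e ≤ v n
    lo n with n ∸ (K + c) in eq
    ... | zero   = ≤-trans (≤-reflexive (*-zeroʳ C)) z≤n
    ... | suc y′ = +-cancelʳ-≤ c _ _ (begin
      C * y ^ suc e + c                         ≤⟨ +-monoʳ-≤ (C * y ^ suc e) c≤ ⟩
      C * y ^ suc e + C * (suc e * c * y ^ e)   ≡⟨ *-distribˡ-+ C _ _ ⟨
      C * (y ^ suc e + suc e * c * y ^ e)       ≤⟨ *-monoʳ-≤ C (bernoulli-lower y c e) ⟩
      C * (y + c) ^ suc e                       ≡⟨ cong (λ x → C * x ^ suc e) y+c≡n∸K ⟩
      C * (n ∸ K) ^ suc e                       ≤⟨ lower s n ⟩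
      u n                                       ≡⟨ u≡v+c n ⟩
      v n + c                                   ∎)
      where
      open ≤-Reasoning
      y = suc y′
      instance _ = m^n≢0 y e
      c≤ : c ≤ C * (suc e * c * y ^ e)
      c≤ = ≤-trans (m≤n*m c (suc e)) (≤-trans (m≤m*n (suc e * c) (y ^ e)) (m≤n*m _ C))
      n∸K∸c≡y : n ∸ K ∸ c ≡ y
      n∸K∸c≡y = trans (∸-+-assoc n K c) eq
      c<n∸K : c < n ∸ K
      c<n∸K = m∸n≢0⇒n<m (λ n∸K∸c≡0 → 0≢1+n (trans (sym n∸K∸c≡0) n∸K∸c≡y))
      y+c≡n∸K : y + c ≡ n ∸ K
      y+c≡n∸K = trans (cong (_+ c) (sym n∸K∸c≡y)) (m∸n+n≡m (<⇒≤ c<n∸K))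

module RationalAsymptotics where

  open import Data.Integer as ℤ using (+_)
  import Data.Integer.Properties as ℤ
  open import Data.List using (List; []; _∷_; length)
  open import Data.List.Relation.Unary.All using (All; []; _∷_)
  open import Data.Nat as ℕ using (ℕ; zero; suc; NonZero; _∸_; _^_; _!; z≤n; s≤s)
  import Data.Nat.Coprimality as Coprime
  import Data.Nat.Properties as ℕ
  open import Data.Nat.Tactic.RingSolver using (solve-∀)
  open import Data.Product using (_×_; _,_)
  open import Data.Rational as ℚ using (ℚ; mkℚ; 0ℚ; 1ℚ; _+_; _*_; _-_; -_; _≤_; _<_; ∣_∣)
  import Data.Rational.Properties as ℚ
  open import Data.Rational.Solver using (module +-*-Solver)
  import Data.Rational.Unnormalised as ℚᵘ
  import Data.Rational.Unnormalised.Properties as ℚᵘ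
  open import Data.Sum using (inj₁; inj₂)
  open import Relation.Binary.PropositionalEquality
  open import Relation.Nullary using (contradiction)
  open Counting
  open Sandwiches

  ℕ→ℚ≡mkℚ : ∀ k → ℕ→ℚ k ≡ mkℚ (+ k) 0 (Coprime.sym (Coprime.1-coprimeTo k))
  ℕ→ℚ≡mkℚ k = ℚ.normalize-coprime _

  inv≡mkℚ : ∀ m → inv (suc m) ≡ mkℚ (+ 1) m (Coprime.1-coprimeTo (suc m))
  inv≡mkℚ m = ℚ.normalize-coprime _

  ℕ→ℚ-+ : ∀ a b → ℕ→ℚ (a ℕ.+ b) ≡ ℕ→ℚ a + ℕ→ℚ b
  ℕ→ℚ-+ a b rewrite ℕ→ℚ≡mkℚ a | ℕ→ℚ≡mkℚ b =
    ℚ./-cong (sym (cong₂ ℤ._+_ (ℤ.*-identityʳ (+ a)) (ℤ.*-identityʳ (+ b)))) refl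

  ℕ→ℚ-* : ∀ a b → ℕ→ℚ (a ℕ.* b) ≡ ℕ→ℚ a * ℕ→ℚ b
  ℕ→ℚ-* a b rewrite ℕ→ℚ≡mkℚ a | ℕ→ℚ≡mkℚ b = ℚ./-cong (sym (ℤ.+◃n≡+n (a ℕ.* b))) refl

  ℕ→ℚ-mono-≤ : ∀ {a b} → a ℕ.≤ b → ℕ→ℚ a ≤ ℕ→ℚ b
  ℕ→ℚ-mono-≤ {a} {b} a≤b rewrite ℕ→ℚ≡mkℚ a | ℕ→ℚ≡mkℚ b =
    ℚ.*≤* (subst₂ ℤ._≤_ (sym (ℤ.*-identityʳ (+ a))) (sym (ℤ.*-identityʳ (+ b))) (ℤ.+≤+ a≤b))

  ℕ→ℚ-pos : ∀ a .{{_ : NonZero a}} → ℚ.Positive (ℕ→ℚ a)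
  ℕ→ℚ-pos (suc a) rewrite ℕ→ℚ≡mkℚ (suc a) = _

  *-inv : ∀ m .{{_ : NonZero m}} → ℕ→ℚ m * inv m ≡ 1ℚ
  *-inv (suc m) rewrite ℕ→ℚ≡mkℚ (suc m) | inv≡mkℚ m = ℚ.*-inverseʳ (mkℚ (+ suc m) 0 (Coprime.sym (Coprime.1-coprimeTo (suc m))))

  inv-* : ∀ a b .{{_ : NonZero a}} .{{_ : NonZero b}} →
          inv (a ℕ.* b) ≡ inv a * inv b
  inv-* a b = sym (begin
    inv a * inv b                                              ≡⟨ sym (ℚ.*-identityˡ _) ⟩
    1ℚ * (inv a * inv b)                                       ≡⟨ cong (_* (inv a * inv b)) (sym (*-inv (a ℕ.* b))) ⟩
    ℕ→ℚ (a ℕ.* b) * inv (a ℕ.* b) * (inv a * inv b)            ≡⟨ cong (λ x → x * inv (a ℕ.* b) * (inv a * inv b)) (ℕ→ℚ-* a b) ⟩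
    ℕ→ℚ a * ℕ→ℚ b * inv (a ℕ.* b) * (inv a * inv b)            ≡⟨ solve 5 (λ x y i j k → x :* y :* k :* (i :* j) := x :* i :* (y :* j) :* k) refl
                                                                    (ℕ→ℚ a) (ℕ→ℚ b) (inv a) (inv b) (inv (a ℕ.* b)) ⟩
    ℕ→ℚ a * inv a * (ℕ→ℚ b * inv b) * inv (a ℕ.* b)            ≡⟨ cong₂ (λ x y → x * y * inv (a ℕ.* b)) (*-inv a) (*-inv b) ⟩
    1ℚ * 1ℚ * inv (a ℕ.* b)                                     ≡⟨ ℚ.*-identityˡ _ ⟩
    inv (a ℕ.* b)                                              ∎)
    where
    open ≡-Reasoning
    open +-*-Solver
    instance _ = ℕ.m*n≢0 a b

  inv-denominator≤ : ∀ ε → 0ℚ < ε → inv (suc (ℚ.denominator-1 ε)) ≤ ε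
  inv-denominator≤ (mkℚ (+ suc p) d _) _ rewrite inv≡mkℚ d =
    ℚ.*≤* (ℤ.+≤+ (ℕ.*-monoˡ-≤ (suc d) {1} {suc p} (s≤s z≤n)))
  inv-denominator≤ (mkℚ (+ zero) d _) (ℚ.*<* (ℤ.+<+ ()))
  inv-denominator≤ (mkℚ ℤ.-[1+ p ] d _) (ℚ.*<* ())

  ≤-via-ℕ : ∀ w .{{_ : NonZero w}} {x y} p q → x * ℕ→ℚ w ≡ ℕ→ℚ p → y * ℕ→ℚ w ≡ ℕ→ℚ q → p ℕ.≤ q → x ≤ y
  ≤-via-ℕ w p q xw≡p yw≡q p≤q =
    ℚ.*-cancelʳ-≤-pos (ℕ→ℚ w) {{ℕ→ℚ-pos w}} (subst₂ _≤_ (sym xw≡p) (sym yw≡q) (ℕ→ℚ-mono-≤ p≤q))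

  ≤-inv-* : ∀ k {x y} → ℕ→ℚ (suc k) * x ≤ y → x ≤ inv (suc k) * y
  ≤-inv-* k {x} {y} kx≤y = subst (_≤ inv (suc k) * y) cancel
    (ℚ.*-monoˡ-≤-nonNeg (inv (suc k)) {{inv-nonNeg}} kx≤y)
    where
    inv-nonNeg : ℚ.NonNegative (inv (suc k))
    inv-nonNeg rewrite inv≡mkℚ k = _
    cancel : inv (suc k) * (ℕ→ℚ (suc k) * x) ≡ x
    cancel = begin
      inv (suc k) * (ℕ→ℚ (suc k) * x)   ≡⟨ sym (ℚ.*-assoc (inv (suc k)) (ℕ→ℚ (suc k)) x) ⟩
      inv (suc k) * ℕ→ℚ (suc k) * x     ≡⟨ cong (_* x) (trans (ℚ.*-comm (inv (suc k)) (ℕ→ℚ (suc k))) (*-inv (suc k))) ⟩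
      1ℚ * x                            ≡⟨ ℚ.*-identityˡ x ⟩
      x                                 ∎
      where open ≡-Reasoning

  ∣-∣≤ : ∀ {x y} → x ≤ y → - x ≤ y → ∣ x ∣ ≤ y
  ∣-∣≤ {x} x≤y -x≤y with ℚ.∣p∣≡p∨∣p∣≡-p x
  ... | inj₁ ∣x∣≡x  = subst (_≤ _) (sym ∣x∣≡x) x≤y
  ... | inj₂ ∣x∣≡-x = subst (_≤ _) (sym ∣x∣≡-x) -x≤y

  *-diff≤ : ∀ c {a b d} → c * a ≤ c * b + d → c * (a - b) ≤ d
  *-diff≤ c {a} {b} {d} ca≤cb+d = begin
    c * (a - b)          ≡⟨ solve 3 (λ c a b → c :* (a :- b) := c :* a :- c :* b) refl c a b ⟩
    c * a - c * b        ≤⟨ ℚ.+-monoˡ-≤ (- (c * b)) ca≤cb+d ⟩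
    c * b + d - c * b    ≡⟨ solve 2 (λ x d → x :+ d :- x := d) refl (c * b) d ⟩
    d                    ∎
    where
    open ℚ.≤-Reasoning
    open +-*-Solver

  ∣-∣≤-relative : ∀ k {a b} → ℕ→ℚ (suc k) * a ≤ ℕ→ℚ (suc k) * b + b →
                  ℕ→ℚ (suc k) * b ≤ ℕ→ℚ (suc k) * a + b → ∣ a - b ∣ ≤ inv (suc k) * b
  ∣-∣≤-relative k {a} {b} ka≤kb+b kb≤ka+b = ∣-∣≤
    (≤-inv-* k (*-diff≤ (ℕ→ℚ (suc k)) ka≤kb+b))
    (subst (_≤ inv (suc k) * b) (solve 2 (λ a b → b :- a := :- (a :- b)) refl a b)
      (≤-inv-* k (*-diff≤ (ℕ→ℚ (suc k)) kb≤ka+b)))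
    where open +-*-Solver

  ≈∞⇒∼ : ∀ (a b : ℕ → ℚ) {u v : ℕ → ℕ} (w : ℕ → ℕ) → (∀ n → NonZero (w n)) →
         (∀ n → a n * ℕ→ℚ (w n) ≡ ℕ→ℚ (u n)) → (∀ n → b n * ℕ→ℚ (w n) ≡ ℕ→ℚ (v n)) →
         u ≈∞ v → a ∼ b
  ≈∞⇒∼ a b {u} {v} w w≢0 a*w b*w u≈v ε ε>0 with u≈v (ℚ.denominator-1 ε)
  ... | M , close = M , λ n M≤n → bound n (close n M≤n)
    where
    k = ℚ.denominator-1 ε
    K = ℕ→ℚ (suc k)
    bound : ∀ n → k ℕ.* v n ℕ.≤ suc k ℕ.* u n × suc k ℕ.* u n ℕ.≤ suc (suc k) ℕ.* v n → ∣ a n - b n ∣ ≤ ε * ∣ b n ∣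
    bound n (lo , hi) = begin
      ∣ a n - b n ∣      ≤⟨ ∣-∣≤-relative k Ka≤Kb+b Kb≤Ka+b ⟩
      inv (suc k) * b n  ≤⟨ ℚ.*-monoʳ-≤-nonNeg (b n) {{ℚ.nonNegative b≥0}} (inv-denominator≤ ε ε>0) ⟩
      ε * b n            ≡⟨ cong (ε *_) (ℚ.0≤p⇒∣p∣≡p b≥0) ⟨
      ε * ∣ b n ∣        ∎
      where
      open ℚ.≤-Reasoning
      instance _ = w≢0 n
      W = ℕ→ℚ (w n)
      scaled : ∀ c x p → x * W ≡ ℕ→ℚ p → ℕ→ℚ c * x * W ≡ ℕ→ℚ (c ℕ.* p)
      scaled c x p xW = trans (ℚ.*-assoc (ℕ→ℚ c) x W) (trans (cong (ℕ→ℚ c *_) xW) (sym (ℕ→ℚ-* c p)))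
      plus : ∀ x y p q → x * W ≡ ℕ→ℚ p → y * W ≡ ℕ→ℚ q → (x + y) * W ≡ ℕ→ℚ (p ℕ.+ q)
      plus x y p q xW yW = trans (ℚ.*-distribʳ-+ W x y) (trans (cong₂ _+_ xW yW) (sym (ℕ→ℚ-+ p q)))
      b≥0 : 0ℚ ≤ b n
      b≥0 = ≤-via-ℕ (w n) {0ℚ} 0 (v n) (ℚ.*-zeroˡ W) (b*w n) z≤n
      ku = suc k ℕ.* u n
      kv = suc k ℕ.* v n
      Ka≤Kb+b : K * a n ≤ K * b n + b n
      Ka≤Kb+b = ≤-via-ℕ (w n) ku (kv ℕ.+ v n) (scaled (suc k) (a n) (u n) (a*w n))
        (plus (K * b n) (b n) kv (v n) (scaled (suc k) (b n) (v n) (b*w n)) (b*w n))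
        (subst (ku ℕ.≤_) (ℕ.+-comm (v n) kv) hi)
      Kb≤Ka+b : K * b n ≤ K * a n + b n
      Kb≤Ka+b = ≤-via-ℕ (w n) kv (ku ℕ.+ v n) (scaled (suc k) (b n) (v n) (b*w n))
        (plus (K * a n) (b n) ku (v n) (scaled (suc k) (a n) (u n) (a*w n)) (b*w n))
        (subst (kv ℕ.≤_) (ℕ.+-comm (v n) ku) (ℕ.+-monoʳ-≤ (v n) lo))

  ℕ→ℚ-*³ : ∀ a b c → ℕ→ℚ (a ℕ.* (b ℕ.* c)) ≡ ℕ→ℚ a * (ℕ→ℚ b * ℕ→ℚ c)
  ℕ→ℚ-*³ a b c = trans (ℕ→ℚ-* a (b ℕ.* c)) (cong (ℕ→ℚ a *_) (ℕ→ℚ-* b c))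

  record Sandwichedℚ (f : ℕ → ℕ) (q : ℚ) (e : ℕ) : Set where
    field
      den num   : ℕ
      den≢0     : NonZero den
      q*den≡num : q * ℕ→ℚ den ≡ ℕ→ℚ num
      sandwich  : Sandwiched (λ n → den ℕ.* f n) num e

  open Sandwichedℚ

  Sandwichedℚ-ext : ∀ {f g q e} → (∀ n → f n ≡ g n) → Sandwichedℚ f q e → Sandwichedℚ g q e
  Sandwichedℚ-ext f≗g s = record
    { den = den s ; num = num s ; den≢0 = den≢0 s ; q*den≡num = q*den≡num s
    ; sandwich = Sandwiched-ext (λ n → cong (den s ℕ.*_) (f≗g n)) (sandwich s) }

  Sandwichedℚ-zero : ∀ e → Sandwichedℚ (λ _ → 0) 0ℚ e
  Sandwichedℚ-zero e = record
    { den = 1 ; num = 0 ; den≢0 = _ ; q*den≡num = refl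
    ; sandwich = sandwiched 0 (λ _ → z≤n) (λ _ → z≤n) }

  Sandwichedℚ-one : Sandwichedℚ (λ _ → 1) 1ℚ 0
  Sandwichedℚ-one = record
    { den = 1 ; num = 1 ; den≢0 = _ ; q*den≡num = refl ; sandwich = Sandwiched-const 1 }

  Sandwichedℚ-+ : ∀ {f g q r e} → Sandwichedℚ f q e → Sandwichedℚ g r e → Sandwichedℚ (λ n → f n ℕ.+ g n) (q + r) e
  Sandwichedℚ-+ {f} {g} {q} {r} s t = record
    { den = D₁ ℕ.* D₂
    ; num = D₂ ℕ.* C₁ ℕ.+ D₁ ℕ.* C₂
    ; den≢0 = ℕ.m*n≢0 D₁ D₂ {{den≢0 s}} {{den≢0 t}}
    ; q*den≡num = begin
        (q + r) * ℕ→ℚ (D₁ ℕ.* D₂)                         ≡⟨ cong ((q + r) *_) (ℕ→ℚ-* D₁ D₂) ⟩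
        (q + r) * (ℕ→ℚ D₁ * ℕ→ℚ D₂)
          ≡⟨ solve 4 (λ q r d₁ d₂ → (q :+ r) :* (d₁ :* d₂) := d₂ :* (q :* d₁) :+ d₁ :* (r :* d₂)) refl q r (ℕ→ℚ D₁) (ℕ→ℚ D₂) ⟩
        ℕ→ℚ D₂ * (q * ℕ→ℚ D₁) + ℕ→ℚ D₁ * (r * ℕ→ℚ D₂)     ≡⟨ cong₂ (λ x y → ℕ→ℚ D₂ * x + ℕ→ℚ D₁ * y) (q*den≡num s) (q*den≡num t) ⟩
        ℕ→ℚ D₂ * ℕ→ℚ C₁ + ℕ→ℚ D₁ * ℕ→ℚ C₂                 ≡⟨ cong₂ _+_ (ℕ→ℚ-* D₂ C₁) (ℕ→ℚ-* D₁ C₂) ⟨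
        ℕ→ℚ (D₂ ℕ.* C₁) + ℕ→ℚ (D₁ ℕ.* C₂)                 ≡⟨ ℕ→ℚ-+ (D₂ ℕ.* C₁) (D₁ ℕ.* C₂) ⟨
        ℕ→ℚ (D₂ ℕ.* C₁ ℕ.+ D₁ ℕ.* C₂)                     ∎
    ; sandwich = Sandwiched-ext (λ n → regroup D₁ D₂ (f n) (g n))
        (Sandwiched-+ (Sandwiched-* (Sandwiched-const D₂) (sandwich s)) (Sandwiched-* (Sandwiched-const D₁) (sandwich t)))
    }
    where
    open ≡-Reasoning
    open +-*-Solver
    D₁ = den s ; C₁ = num s ; D₂ = den t ; C₂ = num t
    regroup : ∀ d₁ d₂ x y → d₂ ℕ.* (d₁ ℕ.* x) ℕ.+ d₁ ℕ.* (d₂ ℕ.* y) ≡ d₁ ℕ.* d₂ ℕ.* (x ℕ.+ y)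
    regroup = solve-∀

  Sandwichedℚ-scale : ∀ w {f q e} → Sandwichedℚ f q e → Sandwichedℚ (λ n → w ℕ.* f n) (ℕ→ℚ w * q) e
  Sandwichedℚ-scale w {f} {q} s = record
    { den = den s
    ; num = w ℕ.* num s
    ; den≢0 = den≢0 s
    ; q*den≡num = trans (ℚ.*-assoc (ℕ→ℚ w) q _) (trans (cong (ℕ→ℚ w *_) (q*den≡num s)) (sym (ℕ→ℚ-* w (num s))))
    ; sandwich = Sandwiched-ext (λ n → swap w (den s) (f n)) (Sandwiched-* (Sandwiched-const w) (sandwich s))
    }
    where
    swap : ∀ a b c → a ℕ.* (b ℕ.* c) ≡ b ℕ.* (a ℕ.* c)
    swap = solve-∀

  Sandwichedℚ-geom : ∀ m .{{_ : NonZero m}} {f q e} → Sandwichedℚ f q e →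
                     Sandwichedℚ (geom m f) (q * inv m * inv (suc e)) (suc e)
  Sandwichedℚ-geom m {f} {q} {e} s = record
    { den = D ℕ.* (m ℕ.* suc e)
    ; num = num s
    ; den≢0 = ℕ.m*n≢0 D (m ℕ.* suc e) {{den≢0 s}} {{ℕ.m*n≢0 m (suc e)}}
    ; q*den≡num = begin
        q * inv m * inv (suc e) * ℕ→ℚ (D ℕ.* (m ℕ.* suc e))                  ≡⟨ cong (q * inv m * inv (suc e) *_) (ℕ→ℚ-*³ D m (suc e)) ⟩
        q * inv m * inv (suc e) * (ℕ→ℚ D * (ℕ→ℚ m * ℕ→ℚ (suc e)))
          ≡⟨ solve 6 (λ q a b d x y → q :* a :* b :* (d :* (x :* y)) := q :* d :* ((x :* a) :* (y :* b))) refl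
                     q (inv m) (inv (suc e)) (ℕ→ℚ D) (ℕ→ℚ m) (ℕ→ℚ (suc e)) ⟩
        q * ℕ→ℚ D * ((ℕ→ℚ m * inv m) * (ℕ→ℚ (suc e) * inv (suc e)))
          ≡⟨ cong₂ (λ x y → x * (y * (ℕ→ℚ (suc e) * inv (suc e)))) (q*den≡num s) (*-inv m) ⟩
        ℕ→ℚ (num s) * (1ℚ * (ℕ→ℚ (suc e) * inv (suc e)))                    ≡⟨ cong (λ x → ℕ→ℚ (num s) * (1ℚ * x)) (*-inv (suc e)) ⟩
        ℕ→ℚ (num s) * (1ℚ * 1ℚ)                                              ≡⟨ ℚ.*-identityʳ _ ⟩
        ℕ→ℚ (num s)                                                          ∎
    ; sandwich = Sandwiched-ext rescale (Sandwiched-geom m (sandwich s))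
    }
    where
    open ≡-Reasoning
    open +-*-Solver
    D = den s
    reassoc : ∀ m e D x → m ℕ.* suc e ℕ.* (D ℕ.* x) ≡ D ℕ.* (m ℕ.* suc e) ℕ.* x
    reassoc = solve-∀
    rescale : ∀ n → m ℕ.* suc e ℕ.* geom m (λ n → D ℕ.* f n) n ≡ D ℕ.* (m ℕ.* suc e) ℕ.* geom m f n
    rescale n = trans (cong (m ℕ.* suc e ℕ.*_) (sym (*-Σmult m D (λ _ → f) n))) (reassoc m e D (geom m f n))

  Sandwichedℚ-delay : ∀ m {f q e} → Sandwichedℚ f q (suc e) →
                      Sandwichedℚ (λ n → when (m ℕ.≤? n) (f (n ∸ m))) q (suc e)
  Sandwichedℚ-delay m {f} s = record
    { den = den s ; num = num s ; den≢0 = den≢0 s ; q*den≡num = q*den≡num s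
    ; sandwich = Sandwiched-ext (λ n → sym (*-when (m ℕ.≤? n) (den s) (f (n ∸ m)))) (Sandwiched-delay m (sandwich s)) }

  Sandwichedℚ-weightedGeom : ∀ m .{{_ : NonZero m}} {f q e} → Sandwichedℚ f q e →
    Sandwichedℚ (weightedGeom m f) (q * inv m * inv (suc e) * inv m * inv (suc (suc e))) (suc (suc e))
  Sandwichedℚ-weightedGeom m {f} s = Sandwichedℚ-ext (λ n → sym (weightedGeom-rec m f n))
    (Sandwichedℚ-delay m (Sandwichedℚ-geom m (Sandwichedℚ-geom m s)))

  Sandwichedℚ-pred : ∀ {f g q e} → Sandwichedℚ f q (suc e) → (∀ n → f n ≡ g n ℕ.+ 1) → Sandwichedℚ g q (suc e)
  Sandwichedℚ-pred {f} {g} s f≡g+1 = record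
    { den = D ; num = num s ; den≢0 = den≢0 s ; q*den≡num = q*den≡num s
    ; sandwich = Sandwiched-∸ D {{num≢0}} (sandwich s) λ n →
        trans (cong (D ℕ.*_) (f≡g+1 n)) (trans (ℕ.*-distribˡ-+ D (g n) 1) (cong (D ℕ.* g n ℕ.+_) (ℕ.*-identityʳ D)))
    }
    where
    D = den s
    num≢0 : NonZero (num s)
    num≢0 = Sandwiched-nonZero (sandwich s) 0 {{ℕ.m*n≢0 D (f 0) {{den≢0 s}} {{f0≢0}}}}
      where
      f0≢0 : NonZero (f 0)
      f0≢0 = subst NonZero (sym (trans (f≡g+1 0) (ℕ.+-comm (g 0) 1))) _

  Sandwichedℚ⇒∼ : ∀ {f q e} → Sandwichedℚ f q e → (λ n → ℕ→ℚ (f n)) ∼ (λ n → q * ℕ→ℚ (n ^ e))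
  Sandwichedℚ⇒∼ {f} {q} {e} s = ≈∞⇒∼ (λ n → ℕ→ℚ (f n)) (λ n → q * ℕ→ℚ (n ^ e)) (λ _ → den s) (λ _ → den≢0 s)
    (λ n → trans (ℚ.*-comm (ℕ→ℚ (f n)) (ℕ→ℚ (den s))) (sym (ℕ→ℚ-* (den s) (f n))))
    (λ n → begin
      q * ℕ→ℚ (n ^ e) * ℕ→ℚ (den s)   ≡⟨ solve 3 (λ q x d → q :* x :* d := q :* d :* x) refl q (ℕ→ℚ (n ^ e)) (ℕ→ℚ (den s)) ⟩
      q * ℕ→ℚ (den s) * ℕ→ℚ (n ^ e)   ≡⟨ cong (_* ℕ→ℚ (n ^ e)) (q*den≡num s) ⟩
      ℕ→ℚ (num s) * ℕ→ℚ (n ^ e)       ≡⟨ ℕ→ℚ-* (num s) (n ^ e) ⟨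
      ℕ→ℚ (num s ℕ.* n ^ e)           ∎)
    (Sandwiched⇒≈∞ (sandwich s) (Sandwiched-monomial (num s) e))
    where
    open ≡-Reasoning
    open +-*-Solver

  Sandwichedℚ-mean : ∀ {Ω S : ℕ → ℕ} {q r e} → Sandwichedℚ Ω q (suc e) → Sandwichedℚ S r e →
                     (∀ n → NonZero (S n)) → (t : ℚ) → t * r ≡ q →
                     (a : ℕ → ℚ) → (∀ n → a n * ℕ→ℚ (S n) ≡ ℕ→ℚ (Ω n)) → a ∼ (λ n → t * ℕ→ℚ n)
  Sandwichedℚ-mean {Ω} {S} {q} {r} {e} sΩ sS S≢0 t t*r≡q a a*S≡Ω =
    ≈∞⇒∼ a (λ n → t * ℕ→ℚ n) w w≢0 a*w t*w (Sandwiched⇒≈∞ Ω-side n-S-side)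
    where
    open ≡-Reasoning
    open +-*-Solver
    DΩ = den sΩ ; CΩ = num sΩ ; DS = den sS ; CS = num sS
    -- Clearing denominators, both CS·DΩ·Ω n and CΩ·n·DS·S n are sandwiched by CS·CΩ·nᵉ⁺¹.
    CS≢0 : NonZero CS
    CS≢0 = Sandwiched-nonZero (sandwich sS) 0 {{ℕ.m*n≢0 DS (S 0) {{den≢0 sS}} {{S≢0 0}}}}
    w : ℕ → ℕ
    w n = CS ℕ.* (DΩ ℕ.* S n)
    w≢0 : ∀ n → NonZero (w n)
    w≢0 n = ℕ.m*n≢0 CS _ {{CS≢0}} {{ℕ.m*n≢0 DΩ (S n) {{den≢0 sΩ}} {{S≢0 n}}}}
    Ω-side : Sandwiched (λ n → CS ℕ.* (DΩ ℕ.* Ω n)) (CS ℕ.* CΩ) (suc e)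
    Ω-side = Sandwiched-* (Sandwiched-const CS) (sandwich sΩ)
    n-S-side : Sandwiched (λ n → CΩ ℕ.* (n ℕ.* (DS ℕ.* S n))) (CS ℕ.* CΩ) (suc e)
    n-S-side = subst (λ C → Sandwiched (λ n → CΩ ℕ.* (n ℕ.* (DS ℕ.* S n))) C (suc e)) CΩ*[1*CS]≡CS*CΩ
      (Sandwiched-* (Sandwiched-const CΩ) (Sandwiched-* Sandwiched-id (sandwich sS)))
      where
      CΩ*[1*CS]≡CS*CΩ : CΩ ℕ.* (1 ℕ.* CS) ≡ CS ℕ.* CΩ
      CΩ*[1*CS]≡CS*CΩ = trans (cong (CΩ ℕ.*_) (ℕ.*-identityˡ CS)) (ℕ.*-comm CΩ CS)
    a*w : ∀ n → a n * ℕ→ℚ (w n) ≡ ℕ→ℚ (CS ℕ.* (DΩ ℕ.* Ω n))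
    a*w n = begin
      a n * ℕ→ℚ (CS ℕ.* (DΩ ℕ.* S n))          ≡⟨ cong (a n *_) (ℕ→ℚ-*³ CS DΩ (S n)) ⟩
      a n * (ℕ→ℚ CS * (ℕ→ℚ DΩ * ℕ→ℚ (S n)))    ≡⟨ solve 4 (λ a c d s → a :* (c :* (d :* s)) := c :* (d :* (a :* s))) refl
                                                    (a n) (ℕ→ℚ CS) (ℕ→ℚ DΩ) (ℕ→ℚ (S n)) ⟩
      ℕ→ℚ CS * (ℕ→ℚ DΩ * (a n * ℕ→ℚ (S n)))    ≡⟨ cong (λ x → ℕ→ℚ CS * (ℕ→ℚ DΩ * x)) (a*S≡Ω n) ⟩
      ℕ→ℚ CS * (ℕ→ℚ DΩ * ℕ→ℚ (Ω n))            ≡⟨ ℕ→ℚ-*³ CS DΩ (Ω n) ⟨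
      ℕ→ℚ (CS ℕ.* (DΩ ℕ.* Ω n))                ∎
    t*w : ∀ n → t * ℕ→ℚ n * ℕ→ℚ (w n) ≡ ℕ→ℚ (CΩ ℕ.* (n ℕ.* (DS ℕ.* S n)))
    t*w n = begin
      t * x * ℕ→ℚ (CS ℕ.* (DΩ ℕ.* S n))            ≡⟨ cong (t * x *_) (ℕ→ℚ-*³ CS DΩ (S n)) ⟩
      t * x * (ℕ→ℚ CS * (ℕ→ℚ DΩ * s))              ≡⟨ cong (λ c → t * x * (c * (ℕ→ℚ DΩ * s))) (q*den≡num sS) ⟨
      t * x * (r * ℕ→ℚ DS * (ℕ→ℚ DΩ * s))
        ≡⟨ solve 6 (λ t x r d d′ s → t :* x :* (r :* d :* (d′ :* s)) := t :* r :* d′ :* (x :* (d :* s))) refl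
                   t x r (ℕ→ℚ DS) (ℕ→ℚ DΩ) s ⟩
      t * r * ℕ→ℚ DΩ * (x * (ℕ→ℚ DS * s))          ≡⟨ cong (λ y → y * ℕ→ℚ DΩ * (x * (ℕ→ℚ DS * s))) t*r≡q ⟩
      q * ℕ→ℚ DΩ * (x * (ℕ→ℚ DS * s))              ≡⟨ cong (_* (x * (ℕ→ℚ DS * s))) (q*den≡num sΩ) ⟩
      ℕ→ℚ CΩ * (x * (ℕ→ℚ DS * s))                  ≡⟨ cong (ℕ→ℚ CΩ *_) (ℕ→ℚ-*³ n DS (S n)) ⟨
      ℕ→ℚ CΩ * ℕ→ℚ (n ℕ.* (DS ℕ.* S n))            ≡⟨ ℕ→ℚ-* CΩ _ ⟨
      ℕ→ℚ (CΩ ℕ.* (n ℕ.* (DS ℕ.* S n)))            ∎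
      where
      x = ℕ→ℚ n
      s = ℕ→ℚ (S n)

  /-* : ∀ a b .{{_ : NonZero b}} → (+ a ℚ./ b) * ℕ→ℚ b ≡ ℕ→ℚ a
  /-* a (suc b) = ℚ.toℚᵘ-injective (begin
    ℚ.toℚᵘ ((+ a ℚ./ suc b) * ℕ→ℚ (suc b))                ≈⟨ ℚ.toℚᵘ-homo-* (+ a ℚ./ suc b) (ℕ→ℚ (suc b)) ⟩
    ℚ.toℚᵘ (+ a ℚ./ suc b) ℚᵘ.* ℚ.toℚᵘ (ℕ→ℚ (suc b))
      ≈⟨ ℚᵘ.*-cong (ℚ.toℚᵘ-fromℚᵘ (ℚᵘ.mkℚᵘ (+ a) b)) (ℚ.toℚᵘ-fromℚᵘ (ℚᵘ.mkℚᵘ (+ suc b) 0)) ⟩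
    ℚᵘ.mkℚᵘ (+ a) b ℚᵘ.* ℚᵘ.mkℚᵘ (+ suc b) 0              ≈⟨ ℚᵘ.*≡* cross ⟩
    ℚᵘ.mkℚᵘ (+ a) 0                                       ≈⟨ ℚᵘ.≃-sym (ℚ.toℚᵘ-fromℚᵘ (ℚᵘ.mkℚᵘ (+ a) 0)) ⟩
    ℚ.toℚᵘ (ℕ→ℚ a)                                        ∎)
    where
    open import Relation.Binary.Reasoning.Setoid ℚᵘ.≃-setoid
    cross : (+ a ℤ.* + suc b) ℤ.* + 1 ≡ + a ℤ.* + (suc b ℕ.* 1)
    cross = trans (ℤ.*-identityʳ _) (cong (λ z → + a ℤ.* + z) (sym (ℕ.*-identityʳ (suc b))))

  mean-* : ∀ Ωc N n → mean Ωc N n * ℕ→ℚ (RCoef N n) ≡ ℕ→ℚ (Ωc N n)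
  mean-* Ωc N n = /-* (Ωc N n) (RCoef N n) {{ℕ.>-nonZero (RCoef-pos N n)}}

  inv-! : ∀ d → inv (suc d !) ≡ inv (suc d) * inv (d !)
  inv-! d = inv-* (suc d) (d !) {{_}} {{d ℕ.!≢0}}

  inv-!² : ∀ d → inv (suc (suc d) !) ≡ inv (suc (suc d)) * (inv (suc d) * inv (d !))
  inv-!² d = trans (inv-! (suc d)) (cong (inv (suc (suc d)) *_) (inv-! d))

  RCoef-sandwiched : ∀ {N} → All NonZero N → Sandwichedℚ (RCoef N) (prodInv N * inv (length N !)) (length N)
  RCoef-sandwiched []                      = Sandwichedℚ-ext (λ n → sym (RCoef-[] n)) Sandwichedℚ-one
  RCoef-sandwiched {m ∷ ms} (m≢0 ∷ ms≢0) = Sandwichedℚ-ext (λ n → sym (RCoef-∷ m {{m≢0}} ms n))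
    (subst (λ q → Sandwichedℚ (geom m (RCoef ms)) q (suc d)) constant (Sandwichedℚ-geom m {{m≢0}} (RCoef-sandwiched ms≢0)))
    where
    open ≡-Reasoning
    open +-*-Solver
    d = length ms
    constant : prodInv ms * inv (d !) * inv m * inv (suc d) ≡ inv m * prodInv ms * inv (suc d !)
    constant = begin
      prodInv ms * inv (d !) * inv m * inv (suc d)
        ≡⟨ solve 4 (λ p f a i → p :* f :* a :* i := a :* p :* (i :* f)) refl (prodInv ms) (inv (d !)) (inv m) (inv (suc d)) ⟩
      inv m * prodInv ms * (inv (suc d) * inv (d !))       ≡⟨ cong (inv m * prodInv ms *_) (inv-! d) ⟨
      inv m * prodInv ms * inv (suc d !)                   ∎

  ΩχCoef-sandwiched : ∀ {N} → All NonZero N →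
                      Sandwichedℚ (ΩχCoef N) (inv (suc (length N) !) * prodInv N * sumInv N) (suc (length N))
  ΩχCoef-sandwiched []                      = Sandwichedℚ-ext (λ n → sym (ΩχCoef-[] n)) (Sandwichedℚ-zero 1)
  ΩχCoef-sandwiched {m ∷ ms} (m≢0 ∷ ms≢0) = Sandwichedℚ-ext (λ n → sym (ΩχCoef-∷ m {{m≢0}} ms n))
    (subst (λ q → Sandwichedℚ (λ n → weightedGeom m (RCoef ms) n ℕ.+ geom m (ΩχCoef ms) n) q (suc (suc d))) constant
      (Sandwichedℚ-+ (Sandwichedℚ-weightedGeom m {{m≢0}} (RCoef-sandwiched ms≢0))
                     (Sandwichedℚ-geom m {{m≢0}} (ΩχCoef-sandwiched ms≢0))))
    where
    open ≡-Reasoning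
    open +-*-Solver
    d = length ms
    P = prodInv ms ; S = sumInv ms ; f = inv (d !) ; a = inv m ; i₁ = inv (suc d) ; i₂ = inv (suc (suc d))
    constant : P * f * a * i₁ * a * i₂ + inv (suc d !) * P * S * a * i₂ ≡ inv (suc (suc d) !) * (a * P) * (a + S)
    constant = begin
      P * f * a * i₁ * a * i₂ + inv (suc d !) * P * S * a * i₂   ≡⟨ cong (λ x → P * f * a * i₁ * a * i₂ + x * P * S * a * i₂) (inv-! d) ⟩
      P * f * a * i₁ * a * i₂ + i₁ * f * P * S * a * i₂          ≡⟨ solve 6 (λ P S f a i₁ i₂ →
                                                                      P :* f :* a :* i₁ :* a :* i₂ :+ i₁ :* f :* P :* S :* a :* i₂
                                                                      := i₂ :* (i₁ :* f) :* (a :* P) :* (a :+ S)) refl P S f a i₁ i₂ ⟩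
      i₂ * (i₁ * f) * (a * P) * (a + S)                           ≡⟨ cong (λ x → x * (a * P) * (a + S)) (inv-!² d) ⟨
      inv (suc (suc d) !) * (a * P) * (a + S)                     ∎

  ΩξCoef-sandwiched : ∀ {N} → All NonZero N →
                      Sandwichedℚ (ΩξCoef N) (ℕ→ℚ (length N) * inv (suc (length N) !) * prodInv N) (suc (length N))
  ΩξCoef-sandwiched []                      = Sandwichedℚ-ext (λ n → sym (ΩξCoef-[] n)) (Sandwichedℚ-zero 1)
  ΩξCoef-sandwiched {m ∷ ms} (m≢0 ∷ ms≢0) = Sandwichedℚ-ext (λ n → sym (ΩξCoef-∷ m {{m≢0}} ms n))
    (subst (λ q → Sandwichedℚ (λ n → m ℕ.* weightedGeom m (RCoef ms) n ℕ.+ geom m (ΩξCoef ms) n) q (suc (suc d))) constant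
      (Sandwichedℚ-+ (Sandwichedℚ-scale m (Sandwichedℚ-weightedGeom m {{m≢0}} (RCoef-sandwiched ms≢0)))
                     (Sandwichedℚ-geom m {{m≢0}} (ΩξCoef-sandwiched ms≢0))))
    where
    open ≡-Reasoning
    open +-*-Solver
    d = length ms
    P = prodInv ms ; f = inv (d !) ; a = inv m ; i₁ = inv (suc d) ; i₂ = inv (suc (suc d)) ; x = ℕ→ℚ d
    constant : ℕ→ℚ m * (P * f * a * i₁ * a * i₂) + x * inv (suc d !) * P * a * i₂
             ≡ ℕ→ℚ (suc d) * inv (suc (suc d) !) * (a * P)
    constant = begin
      ℕ→ℚ m * (P * f * a * i₁ * a * i₂) + x * inv (suc d !) * P * a * i₂
        ≡⟨ cong (λ y → ℕ→ℚ m * (P * f * a * i₁ * a * i₂) + x * y * P * a * i₂) (inv-! d) ⟩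
      ℕ→ℚ m * (P * f * a * i₁ * a * i₂) + x * (i₁ * f) * P * a * i₂
        ≡⟨ solve 7 (λ M P f a i₁ i₂ x →
                      M :* (P :* f :* a :* i₁ :* a :* i₂) :+ x :* (i₁ :* f) :* P :* a :* i₂
                   := M :* a :* (i₂ :* (i₁ :* f) :* (a :* P)) :+ x :* (i₂ :* (i₁ :* f) :* (a :* P))) refl
                   (ℕ→ℚ m) P f a i₁ i₂ x ⟩
      ℕ→ℚ m * a * Y + x * Y                                                ≡⟨ cong (λ y → y * Y + x * Y) (*-inv m {{m≢0}}) ⟩
      1ℚ * Y + x * Y                                                       ≡⟨ ℚ.*-distribʳ-+ Y 1ℚ x ⟨
      (1ℚ + x) * Y                                                         ≡⟨ ℚ.*-assoc (1ℚ + x) (i₂ * (i₁ * f)) (a * P) ⟨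
      (1ℚ + x) * (i₂ * (i₁ * f)) * (a * P)                                 ≡⟨ cong₂ (λ y z → y * z * (a * P)) (ℕ→ℚ-+ 1 d) (inv-!² d) ⟨
      ℕ→ℚ (suc d) * inv (suc (suc d) !) * (a * P)                          ∎
      where Y = i₂ * (i₁ * f) * (a * P)

  RCoef≢0 : ∀ N n → NonZero (RCoef N n)
  RCoef≢0 N n = ℕ.>-nonZero (RCoef-pos N n)

  mean-χ-constant : ∀ N → let d = length N in
                    inv (suc d) * sumInv N * (prodInv N * inv (d !)) ≡ inv (suc d !) * prodInv N * sumInv N
  mean-χ-constant N = trans (solve 4 (λ i S P f → i :* S :* (P :* f) := i :* f :* P :* S) refl (inv (suc d)) (sumInv N) (prodInv N) (inv (d !)))
                            (cong (λ x → x * prodInv N * sumInv N) (sym (inv-! d)))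
    where
    open +-*-Solver
    d = length N

  mean-ξ-constant : ∀ N → let d = length N in
                    ℕ→ℚ d * inv (suc d) * (prodInv N * inv (d !)) ≡ ℕ→ℚ d * inv (suc d !) * prodInv N
  mean-ξ-constant N = trans (solve 4 (λ x i P f → x :* i :* (P :* f) := x :* (i :* f) :* P) refl (ℕ→ℚ d) (inv (suc d)) (prodInv N) (inv (d !)))
                            (cong (λ y → ℕ→ℚ d * y * prodInv N) (sym (inv-! d)))
    where
    open +-*-Solver
    d = length N

  R*Coef-∼ : ∀ {N} → All NonZero N → N ≢ [] →
             (λ n → ℕ→ℚ (R*Coef N n)) ∼ (λ n → prodInv N * inv (length N !) * ℕ→ℚ (n ^ length N))
  R*Coef-∼ {[]}    _   []≢[] = contradiction refl []≢[]
  R*Coef-∼ {_ ∷ _} parts≢0 _     = Sandwichedℚ⇒∼ (Sandwichedℚ-pred (RCoef-sandwiched parts≢0) (RCoef≡R*Coef+1 _))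

open import Data.Nat using (ℕ; NonZero; suc; _^_; _+_; _!)
open import Data.List using (List; []; length)
open import Data.List.Relation.Unary.All using (All)
open import Data.List.Relation.Unary.Unique.Propositional using (Unique)
open import Data.Product using (_×_; _,_)
open import Relation.Binary.PropositionalEquality using (_≢_)
open import Data.Rational using (_*_)
import Data.Nat.Properties as ℕ
open RationalAsymptotics

theorem3 : (N : List ℕ) → Unique N → All NonZero N → N ≢ [] →
  let d = length N in
  ((λ n → ℕ→ℚ (RCoef N n)) ∼ (λ n → prodInv N * inv (d !) * ℕ→ℚ (n ^ d)))
  × ((λ n → ℕ→ℚ (R*Coef N n)) ∼ (λ n → prodInv N * inv (d !) * ℕ→ℚ (n ^ d)))
  × ((λ n → ℕ→ℚ (ΩχCoef N n)) ∼ (λ n → inv ((d + 1) !) * prodInv N * sumInv N * ℕ→ℚ (n ^ (d + 1))))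
  × ((λ n → ℕ→ℚ (ΩξCoef N n)) ∼ (λ n → ℕ→ℚ d * inv ((d + 1) !) * prodInv N * ℕ→ℚ (n ^ (d + 1))))
  × ((λ n → mean ΩχCoef N n) ∼ (λ n → inv (d + 1) * sumInv N * ℕ→ℚ n))
  × ((λ n → mean ΩξCoef N n) ∼ (λ n → ℕ→ℚ d * inv (d + 1) * ℕ→ℚ n))
theorem3 N _ parts≢0 N≢[] rewrite ℕ.+-comm (length N) 1 =
    Sandwichedℚ⇒∼ R
  , R*Coef-∼ parts≢0 N≢[]
  , Sandwichedℚ⇒∼ Ωχ
  , Sandwichedℚ⇒∼ Ωξ
  , Sandwichedℚ-mean Ωχ R (RCoef≢0 N) (inv (suc d) * sumInv N) (mean-χ-constant N) (mean ΩχCoef N) (mean-* ΩχCoef N)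
  , Sandwichedℚ-mean Ωξ R (RCoef≢0 N) (ℕ→ℚ d * inv (suc d)) (mean-ξ-constant N) (mean ΩξCoef N) (mean-* ΩξCoef N)
  where
  d  = length N
  R  = RCoef-sandwiched parts≢0
  Ωχ = ΩχCoef-sandwiched parts≢0
  Ωξ = ΩξCoef-sandwiched parts≢0
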